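{- The statistic $\mathrm{mix}'=S_1+T_2$ is Mahonian: for every $n\ge0$ and every integer $m$, the number of $\pi\in\mathfrak{S}_n$ with $\mathrm{mix}'(\pi)=m$ equals the number of $\pi\in\mathfrak{S}_n$ with $\mathrm{inv}(\pi)=m$, where $\mathrm{inv}(\pi)$ is the number of pairs $i<j$ with $\pi(i)>\pi(j)$.
   Context: For $\pi\in\mathfrak{S}_n$: $S_1(\pi)$ is the number of pairs of positions $i<j$ with $\pi(i)<\pi(j)$ and no $l$ with $i<l<j$ and $\pi(l)>\pi(j)$; $T_2(\pi)$ is the number of triples of positions $i<j<k$ with $\pi(k)<\pi(i)<\pi(j)$ and no $l$ with $i<l<k$, $l\ne j$, and $\pi(l)>\pi(j)$. (In mesh-pattern notation, $S_1=(12,\{(1,2)\})$ and $T_2=(231,\{(1,3),(2,3)\})$.) -}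

module Defs where

open import Data.Nat using (ℕ; _+_)
open import Data.Fin using (Fin; _<_; _>_; _≟_)
open import Data.Fin.Properties using (_<?_)
open import Data.Vec using (Vec; lookup)
open import Data.List using (List; length; filter; allFin; cartesianProduct; concatMap; map)
open import Data.Bool using (Bool; T)
open import Data.Product using (_×_; _,_)
open import Relation.Nullary using (¬_; Dec; yes; no; _×-dec_; ¬?)
open import Relation.Nullary.Decidable using (⌊_⌋)
open import Relation.Binary.PropositionalEquality using (_≡_; _≢_)
open import Data.List.Relation.Unary.All using (All; all?)

-- A permutation π ∈ 𝔖ₙ is represented by its one-line notation: a vector
-- (π(0), …, π(n-1)) of elements of Fin n with pairwise distinct entries
-- (injective self-map of a finite set, hence a bijection).
-- Positions and values are 0-based (Fin n); this does not affect the statistics.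

isPermB : ∀ {n} → Vec (Fin n) n → Bool
isPermB {n} v =
  ⌊ all? (λ i → all? (λ j → ¬? (i <? j) ⊎? ¬? (lookup v i ≟ lookup v j)) (allFin n)) (allFin n) ⌋
  where
  open import Data.Sum using (_⊎_)
  open import Relation.Nullary.Decidable using (_⊎-dec_)
  _⊎?_ = _⊎-dec_

record Perm (n : ℕ) : Set where
  constructor perm
  field
    word   : Vec (Fin n) n
    isPerm : T (isPermB word)

open Perm public

count : ∀ {a} {A : Set a} {p} {P : A → Set p} → ((x : A) → Dec (P x)) → List A → ℕ
count P? xs = length (filter P? xs)

module _ {n : ℕ} (π : Perm n) where
  private
    π$ : Fin n → Fin n
    π$ i = lookup (word π) i

  S1-cond : Fin n → Fin n → Set
  S1-cond i j = (i < j) × (π$ i < π$ j) ×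
                All (λ l → ¬ ((i < l) × (l < j) × (π$ l > π$ j))) (allFin n)

  S1-cond? : (i j : Fin n) → Dec (S1-cond i j)
  S1-cond? i j = (i <? j) ×-dec (π$ i <? π$ j) ×-dec
                 all? (λ l → ¬? ((i <? l) ×-dec (l <? j) ×-dec (π$ j <? π$ l))) (allFin n)

  S₁ : ℕ
  S₁ = count (λ (p : Fin n × Fin n) → let (i , j) = p in S1-cond? i j)
             (cartesianProduct (allFin n) (allFin n))

  T2-cond : Fin n → Fin n → Fin n → Set
  T2-cond i j k = (i < j) × (j < k) × (π$ k < π$ i) × (π$ i < π$ j) ×
                  All (λ l → ¬ ((i < l) × (l < k) × (l ≢ j) × (π$ l > π$ j))) (allFin n)

  T2-cond? : (i j k : Fin n) → Dec (T2-cond i j k)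
  T2-cond? i j k = (i <? j) ×-dec (j <? k) ×-dec (π$ k <? π$ i) ×-dec (π$ i <? π$ j) ×-dec
                   all? (λ l → ¬? ((i <? l) ×-dec (l <? k) ×-dec ¬? (l ≟ j) ×-dec (π$ j <? π$ l)))
                        (allFin n)

  triples : List (Fin n × Fin n × Fin n)
  triples = cartesianProduct (allFin n) (cartesianProduct (allFin n) (allFin n))

  T₂ : ℕ
  T₂ = count (λ (t : Fin n × Fin n × Fin n) → let (i , j , k) = t in T2-cond? i j k) triples

  mix′ : ℕ
  mix′ = S₁ + T₂

  inv : ℕ
  inv = count (λ (p : Fin n × Fin n) → let (i , j) = p in (i <? j) ×-dec (π$ j <? π$ i))
              (cartesianProduct (allFin n) (allFin n))

-- Both statistics can be computed by cutting a permutation word w = α n β at its largest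
-- letter n: with cr(α, β) the number of pairs a ∈ α, b ∈ β with a > b,
--   mix′(w) = mix′(α) + mix′(β) + |α| + cr(α, β),   inv(w) = inv(α) + inv(β) + |β| + cr(α, β),
-- and both statistics only see the relative order of the letters.  Record the set of values
-- of α by a 0/1-word s of length n; then |α| = #1(s), cr(α, β) = cr(s) (pairs of a 1 after
-- a 0), and w is determined by s and the standardisations u, v of α and β.  Let s* be s
-- reversed and complemented, and let Φ(w) place Φ(v) on the values marked 1 in s* to the
-- left of n and Φ(u) on those marked 0 to its right.  As s ↦ s* is an involution swapping
-- #1 and #0 and preserving cr, induction on n shows inv(Φ w) = mix′(w) and Φ(Φ w) = w, so
-- Φ maps {mix′ = m} bijectively onto {inv = m}.

module Submission where

open import Data.Bool using (Bool; true; false; _∧_; _∨_; not; if_then_else_; T)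
open import Data.Bool.Properties using (∧-identityʳ; ∧-zeroʳ; ∧-assoc; ∨-zeroʳ; not-involutive; T-≡; T-irrelevant)
open import Data.Nat
open import Data.Nat.Properties
open import Data.Nat.Tactic.RingSolver using (solve-∀)
open import Algebra.Properties.CommutativeSemigroup +-commutativeSemigroup using (x∙yz≈y∙xz; interchange)
open import Data.Fin as Fin using (Fin; zero; suc; toℕ; fromℕ<)
import Data.Fin.Properties as Fin
open import Data.Vec using (Vec; []; _∷_; lookup)
open import Data.List using (List; []; _∷_; [_]; _++_; _∷ʳ_; map; length; reverse; tabulate; allFin; cartesianProduct; upTo)
open import Data.List.Properties
open import Data.List.Relation.Unary.All as All using (All; []; _∷_; all?)
import Data.List.Relation.Unary.All.Properties as All
open import Data.List.Relation.Unary.Any using (here; there)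
open import Data.List.Relation.Unary.AllPairs using ([]; _∷_)
open import Data.List.Relation.Unary.Unique.Propositional using (Unique)
import Data.List.Relation.Unary.Unique.Propositional.Properties as Unique
open import Data.List.Membership.Propositional using (_∈_; _∉_)
open import Data.List.Membership.Propositional.Properties
open import Data.List.Membership.Propositional.Properties.WithK using (unique∧set⇒bag)
open import Data.List.Relation.Binary.BagAndSetEquality using (∼bag⇒↭)
open import Data.List.Relation.Binary.Permutation.Propositional
  using (_↭_; module _↭_; ↭-refl; ↭-prep; ↭-trans; ↭-sym; ↭-reflexive; ↭⇒↭ₛ)
import Data.List.Relation.Binary.Permutation.Propositional.Properties as ↭
open import Data.Product using (Σ; ∃; _×_; _,_; proj₁; proj₂)
open import Data.Sum using (_⊎_; inj₁; inj₂)
open import Data.Empty using (⊥-elim)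
open import Function using (_∘_; id)
open import Function.Bundles using (_↔_; _⇔_; mk⇔; mk↔ₛ′; Equivalence)
open import Function.Properties.Inverse using (↔-trans; ↔-sym)
open import Axiom.UniquenessOfIdentityProofs.WithK using (uip)
open import Relation.Nullary using (¬_; Dec; yes; no; does; ¬?)
open import Relation.Nullary.Decidable using (_⊎-dec_; toWitness; fromWitness)
open import Relation.Binary.Definitions using (tri<; tri≈; tri>)
open import Relation.Binary.PropositionalEquality hiding ([_])
open import Data.List.Relation.Binary.Permutation.Setoid.Properties (setoid ℕ) using (Unique-resp-↭)
open import Defs

open ≡-Reasoning

𝟙 : Bool → ℕ
𝟙 true  = 1
𝟙 false = 0

countᵇ : ∀ {A : Set} → (A → Bool) → List A → ℕ
countᵇ p []       = 0
countᵇ p (x ∷ xs) = 𝟙 (p x) + countᵇ p xs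

sumᶠ : ∀ m → (Fin m → ℕ) → ℕ
sumᶠ zero    f = 0
sumᶠ (suc m) f = f zero + sumᶠ m (f ∘ suc)

allᶠ : ∀ m → (Fin m → Bool) → Bool
allᶠ zero    f = true
allᶠ (suc m) f = f zero ∧ allᶠ m (f ∘ suc)

count≡countᵇ : ∀ {A : Set} {P : A → Set} (P? : ∀ x → Dec (P x)) xs →
               count P? xs ≡ countᵇ (does ∘ P?) xs
count≡countᵇ P? [] = refl
count≡countᵇ P? (x ∷ xs) with does (P? x)
... | true  = cong suc (count≡countᵇ P? xs)
... | false = count≡countᵇ P? xs

countᵇ-++ : ∀ {A : Set} (p : A → Bool) xs ys → countᵇ p (xs ++ ys) ≡ countᵇ p xs + countᵇ p ys
countᵇ-++ p []       ys = refl
countᵇ-++ p (x ∷ xs) ys = trans (cong (𝟙 (p x) +_) (countᵇ-++ p xs ys)) (sym (+-assoc (𝟙 (p x)) _ _))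

countᵇ-map : ∀ {A B : Set} (p : B → Bool) (f : A → B) xs → countᵇ p (map f xs) ≡ countᵇ (p ∘ f) xs
countᵇ-map p f []       = refl
countᵇ-map p f (x ∷ xs) = cong (𝟙 (p (f x)) +_) (countᵇ-map p f xs)

countᵇ-tabulate : ∀ {A : Set} m (p : A → Bool) (f : Fin m → A) →
                  countᵇ p (tabulate f) ≡ sumᶠ m (𝟙 ∘ p ∘ f)
countᵇ-tabulate zero    p f = refl
countᵇ-tabulate (suc m) p f = cong (𝟙 (p (f zero)) +_) (countᵇ-tabulate m p (f ∘ suc))

countᵇ-cartesianProduct : ∀ {A B : Set} m (p : A × B → Bool) (f : Fin m → A) ys →
  countᵇ p (cartesianProduct (tabulate f) ys) ≡ sumᶠ m (λ i → countᵇ (λ y → p (f i , y)) ys)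
countᵇ-cartesianProduct zero    p f ys = refl
countᵇ-cartesianProduct (suc m) p f ys =
  trans (countᵇ-++ p (map (f zero ,_) ys) _)
        (cong₂ _+_ (countᵇ-map p (f zero ,_) ys) (countᵇ-cartesianProduct m p (f ∘ suc) ys))

countᵇ-↭ : ∀ {A : Set} (p : A → Bool) {xs ys : List A} → xs ↭ ys → countᵇ p xs ≡ countᵇ p ys
countᵇ-↭ p _↭_.refl         = refl
countᵇ-↭ p (_↭_.prep x q)   = cong (𝟙 (p x) +_) (countᵇ-↭ p q)
countᵇ-↭ p (_↭_.swap {ys = ys} x y q) =
  trans (cong (λ t → 𝟙 (p x) + (𝟙 (p y) + t)) (countᵇ-↭ p q)) (x∙yz≈y∙xz (𝟙 (p x)) (𝟙 (p y)) (countᵇ p ys))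
countᵇ-↭ p (_↭_.trans q r)  = trans (countᵇ-↭ p q) (countᵇ-↭ p r)

all?-tabulate : ∀ {A : Set} {P : A → Set} m (P? : ∀ x → Dec (P x)) (f : Fin m → A) →
                does (all? P? (tabulate f)) ≡ allᶠ m (does ∘ P? ∘ f)
all?-tabulate zero    P? f = refl
all?-tabulate (suc m) P? f = cong (does (P? (f zero)) ∧_) (all?-tabulate m P? (f ∘ suc))

sumᶠ-cong : ∀ m {f g : Fin m → ℕ} → (∀ i → f i ≡ g i) → sumᶠ m f ≡ sumᶠ m g
sumᶠ-cong zero    eq = refl
sumᶠ-cong (suc m) eq = cong₂ _+_ (eq zero) (sumᶠ-cong m (eq ∘ suc))

sumᶠ-zero : ∀ m → sumᶠ m (λ _ → 0) ≡ 0
sumᶠ-zero zero    = refl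
sumᶠ-zero (suc m) = sumᶠ-zero m

sumᶠ-if : ∀ m b (f : Fin m → ℕ) → sumᶠ m (λ k → if b then f k else 0) ≡ (if b then sumᶠ m f else 0)
sumᶠ-if m true  f = refl
sumᶠ-if m false f = sumᶠ-zero m

allᶠ-true : ∀ m → allᶠ m (λ _ → true) ≡ true
allᶠ-true zero    = refl
allᶠ-true (suc m) = allᶠ-true m

infix 4 _<ᶠ_

_<ᶠ_ : ∀ {m} → Fin m → Fin m → Bool
i <ᶠ j = toℕ i <ᵇ toℕ j

S₁ᶠ : ∀ m → (Fin m → ℕ) → ℕ
S₁ᶠ m p = sumᶠ m λ i → sumᶠ m λ j →
  𝟙 ((i <ᶠ j) ∧ (p i <ᵇ p j) ∧ allᶠ m λ l → not ((i <ᶠ l) ∧ (l <ᶠ j) ∧ (p j <ᵇ p l)))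

T₂ᶠ : ∀ m → (Fin m → ℕ) → ℕ
T₂ᶠ m p = sumᶠ m λ i → sumᶠ m λ j → sumᶠ m λ k →
  𝟙 ((i <ᶠ j) ∧ (j <ᶠ k) ∧ (p k <ᵇ p i) ∧ (p i <ᵇ p j) ∧
     allᶠ m λ l → not ((i <ᶠ l) ∧ (l <ᶠ k) ∧ not (does (l Fin.≟ j)) ∧ (p j <ᵇ p l)))

invᶠ : ∀ m → (Fin m → ℕ) → ℕ
invᶠ m p = sumᶠ m λ i → sumᶠ m λ j → 𝟙 ((i <ᶠ j) ∧ (p j <ᵇ p i))

module _ {n : ℕ} (π : Perm n) where

  values : Fin n → ℕ
  values = toℕ ∘ lookup (word π)

  S₁≡S₁ᶠ : S₁ π ≡ S₁ᶠ n values
  S₁≡S₁ᶠ =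
    trans (count≡countᵇ _ (cartesianProduct (allFin n) (allFin n)))
    (trans (countᵇ-cartesianProduct n _ id (allFin n))
    (sumᶠ-cong n λ i → trans (countᵇ-tabulate n _ id)
    (sumᶠ-cong n λ j → cong (λ b → 𝟙 ((i <ᶠ j) ∧ (values i <ᵇ values j) ∧ b)) (all?-tabulate n _ id))))

  T₂≡T₂ᶠ : T₂ π ≡ T₂ᶠ n values
  T₂≡T₂ᶠ =
    trans (count≡countᵇ _ (triples π))
    (trans (countᵇ-cartesianProduct n _ id _)
    (sumᶠ-cong n λ i → trans (countᵇ-cartesianProduct n _ id (allFin n))
    (sumᶠ-cong n λ j → trans (countᵇ-tabulate n _ id)
    (sumᶠ-cong n λ k →
      cong (λ b → 𝟙 ((i <ᶠ j) ∧ (j <ᶠ k) ∧ (values k <ᵇ values i) ∧ (values i <ᵇ values j) ∧ b))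
           (all?-tabulate n _ id)))))

  inv≡invᶠ : inv π ≡ invᶠ n values
  inv≡invᶠ =
    trans (count≡countᵇ _ (cartesianProduct (allFin n) (allFin n)))
    (trans (countᵇ-cartesianProduct n _ id (allFin n))
    (sumᶠ-cong n λ i → countᵇ-tabulate n _ id))

true≢false : true ≢ false
true≢false ()

≡ᵇ-refl : ∀ n → (n ≡ᵇ n) ≡ true
≡ᵇ-refl n = Equivalence.to T-≡ (≡⇒≡ᵇ n n refl)

<ᵇ-true : ∀ {m n} → m < n → (m <ᵇ n) ≡ true
<ᵇ-true = Equivalence.to T-≡ ∘ <⇒<ᵇ

<ᵇ-false : ∀ {m n} → n ≤ m → (m <ᵇ n) ≡ false
<ᵇ-false {m} {n} n≤m with m <ᵇ n in eq
... | true  = ⊥-elim (<⇒≱ (<ᵇ⇒< m n (Equivalence.from T-≡ eq)) n≤m)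
... | false = refl

≤ᵇ-true : ∀ {m n} → m ≤ n → (m ≤ᵇ n) ≡ true
≤ᵇ-true = Equivalence.to T-≡ ∘ ≤⇒≤ᵇ

≤ᵇ-false : ∀ {m n} → n < m → (m ≤ᵇ n) ≡ false
≤ᵇ-false {m} {n} n<m with m ≤ᵇ n in eq
... | true  = ⊥-elim (<⇒≱ n<m (≤ᵇ⇒≤ m n (Equivalence.from T-≡ eq)))
... | false = refl

not-<ᵇ : ∀ m n → not (m <ᵇ n) ≡ (n ≤ᵇ m)
not-<ᵇ m n with <-≤-connex m n
... | inj₁ m<n = trans (cong not (<ᵇ-true m<n)) (sym (≤ᵇ-false m<n))
... | inj₂ n≤m = trans (cong not (<ᵇ-false n≤m)) (sym (≤ᵇ-true n≤m))

<ᵇ-∧-≤ᵇ : ∀ m n r → (m <ᵇ n) ∧ (m ≤ᵇ n) ∧ r ≡ (m <ᵇ n) ∧ r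
<ᵇ-∧-≤ᵇ m n r with <-≤-connex m n
... | inj₁ m<n rewrite <ᵇ-true m<n | ≤ᵇ-true (<⇒≤ m<n) = refl
... | inj₂ n≤m rewrite <ᵇ-false n≤m = refl

⊔-≤ᵇ : ∀ m n o → (m ≤ᵇ o) ∧ (n ≤ᵇ o) ≡ (m ⊔ n ≤ᵇ o)
⊔-≤ᵇ m n o with ≤-<-connex m o | ≤-<-connex n o
... | inj₁ m≤o | inj₁ n≤o rewrite ≤ᵇ-true m≤o | ≤ᵇ-true n≤o | ≤ᵇ-true (⊔-lub m≤o n≤o) = refl
... | inj₁ m≤o | inj₂ o<n rewrite ≤ᵇ-true m≤o | ≤ᵇ-false o<n | ≤ᵇ-false (<-≤-trans o<n (m≤n⊔m m n)) = refl
... | inj₂ o<m | _         rewrite ≤ᵇ-false o<m | ≤ᵇ-false (<-≤-trans o<m (m≤m⊔n m n)) = refl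

≤ᵇ-∧-not-<ᵇ : ∀ c y z r → (c ≤ᵇ y) ∧ not (y <ᵇ z) ∧ r ≡ (c ⊔ z ≤ᵇ y) ∧ r
≤ᵇ-∧-not-<ᵇ c y z r rewrite not-<ᵇ y z =
  trans (sym (∧-assoc (c ≤ᵇ y) (z ≤ᵇ y) r)) (cong (_∧ r) (⊔-≤ᵇ c z y))

𝟙-∧-if : ∀ a b r → 𝟙 (a ∧ b ∧ r) ≡ (if b then 𝟙 (a ∧ r) else 0)
𝟙-∧-if true  true  r = refl
𝟙-∧-if true  false r = refl
𝟙-∧-if false true  r = refl
𝟙-∧-if false false r = refl

𝟙-∧-∧-if : ∀ a b c r → 𝟙 (a ∧ b ∧ c ∧ r) ≡ (if b ∧ c then 𝟙 (a ∧ r) else 0)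
𝟙-∧-∧-if a b c r = trans (cong (λ t → 𝟙 (a ∧ t)) (sym (∧-assoc b c r))) (𝟙-∧-if a (b ∧ c) r)

-- The statistics as recursions on the first letter of a word

below : ℕ → List ℕ → ℕ
below x = countᵇ (_<ᵇ x)

-- Pairs and triples whose first position holds the head x of the word x ∷ w; the
-- accumulator c is the largest of x and the letters of w scanned so far.
S₁-from : ℕ → ℕ → List ℕ → ℕ
S₁-from x c []      = 0
S₁-from x c (y ∷ w) = 𝟙 ((x <ᵇ y) ∧ (c ≤ᵇ y)) + S₁-from x (c ⊔ y) w

belowUntil : ℕ → ℕ → List ℕ → ℕ
belowUntil x c []      = 0
belowUntil x c (z ∷ w) = 𝟙 (z <ᵇ x) + (if z ≤ᵇ c then belowUntil x c w else 0)

T₂-from : ℕ → ℕ → List ℕ → ℕ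
T₂-from x c []      = 0
T₂-from x c (y ∷ w) = (if (x <ᵇ y) ∧ (c ≤ᵇ y) then belowUntil x y w else 0) + T₂-from x (c ⊔ y) w

mixᴸ : List ℕ → ℕ
mixᴸ []      = 0
mixᴸ (x ∷ w) = S₁-from x x w + T₂-from x x w + mixᴸ w

invᴸ : List ℕ → ℕ
invᴸ []      = 0
invᴸ (x ∷ w) = below x w + invᴸ w

S₁-fromᶠ : ℕ → ℕ → ∀ m → (Fin m → ℕ) → ℕ
S₁-fromᶠ x c m q = sumᶠ m λ j →
  𝟙 ((x <ᵇ q j) ∧ (c ≤ᵇ q j) ∧ allᶠ m λ l → not ((l <ᶠ j) ∧ (q j <ᵇ q l)))

belowUntilᶠ : ℕ → ℕ → ∀ m → (Fin m → ℕ) → ℕ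
belowUntilᶠ x c m q = sumᶠ m λ k → 𝟙 ((q k <ᵇ x) ∧ allᶠ m λ l → not ((l <ᶠ k) ∧ (c <ᵇ q l)))

T₂-fromᶠ : ℕ → ℕ → ∀ m → (Fin m → ℕ) → ℕ
T₂-fromᶠ x c m q = sumᶠ m λ j → sumᶠ m λ k →
  𝟙 ((j <ᶠ k) ∧ (q k <ᵇ x) ∧ (x <ᵇ q j) ∧ (c ≤ᵇ q j) ∧
     allᶠ m λ l → not ((l <ᶠ k) ∧ not (does (l Fin.≟ j)) ∧ (q j <ᵇ q l)))

S₁-fromᶠ-tabulate : ∀ x c m q → S₁-fromᶠ x c m q ≡ S₁-from x c (tabulate q)
S₁-fromᶠ-tabulate x c zero    q = refl
S₁-fromᶠ-tabulate x c (suc m) q = cong₂ _+_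
  (trans (cong (λ b → 𝟙 ((x <ᵇ q zero) ∧ (c ≤ᵇ q zero) ∧ b)) (allᶠ-true m))
         (cong (λ b → 𝟙 ((x <ᵇ q zero) ∧ b)) (∧-identityʳ _)))
  (trans (sumᶠ-cong m λ j → cong (λ b → 𝟙 ((x <ᵇ q (suc j)) ∧ b)) (≤ᵇ-∧-not-<ᵇ c (q (suc j)) (q zero) _))
         (S₁-fromᶠ-tabulate x (c ⊔ q zero) m (q ∘ suc)))

belowUntilᶠ-tabulate : ∀ x c m q → belowUntilᶠ x c m q ≡ belowUntil x c (tabulate q)
belowUntilᶠ-tabulate x c zero    q = refl
belowUntilᶠ-tabulate x c (suc m) q = cong₂ _+_
  (trans (cong (λ b → 𝟙 ((q zero <ᵇ x) ∧ b)) (allᶠ-true m)) (cong 𝟙 (∧-identityʳ _)))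
  (begin
    sumᶠ m (λ k → 𝟙 ((q (suc k) <ᵇ x) ∧ not (c <ᵇ q zero) ∧ _))
  ≡⟨ sumᶠ-cong m (λ k → 𝟙-∧-if (q (suc k) <ᵇ x) (not (c <ᵇ q zero)) _) ⟩
    sumᶠ m (λ k → if not (c <ᵇ q zero) then _ else 0)
  ≡⟨ sumᶠ-if m (not (c <ᵇ q zero)) _ ⟩
    (if not (c <ᵇ q zero) then belowUntilᶠ x c m (q ∘ suc) else 0)
  ≡⟨ cong₂ (λ b t → if b then t else 0) (not-<ᵇ c (q zero)) (belowUntilᶠ-tabulate x c m (q ∘ suc)) ⟩
    (if q zero ≤ᵇ c then belowUntil x c (tabulate (q ∘ suc)) else 0)
  ∎)

T₂-fromᶠ-tabulate : ∀ x c m q → T₂-fromᶠ x c m q ≡ T₂-from x c (tabulate q)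
T₂-fromᶠ-tabulate x c zero    q = refl
T₂-fromᶠ-tabulate x c (suc m) q = cong₂ _+_
  (begin
    sumᶠ m (λ k → 𝟙 ((q (suc k) <ᵇ x) ∧ (x <ᵇ q zero) ∧ (c ≤ᵇ q zero) ∧ _))
  ≡⟨ sumᶠ-cong m (λ k → 𝟙-∧-∧-if (q (suc k) <ᵇ x) (x <ᵇ q zero) (c ≤ᵇ q zero) _) ⟩
    sumᶠ m (λ k → if (x <ᵇ q zero) ∧ (c ≤ᵇ q zero) then _ else 0)
  ≡⟨ sumᶠ-if m ((x <ᵇ q zero) ∧ (c ≤ᵇ q zero)) _ ⟩
    (if (x <ᵇ q zero) ∧ (c ≤ᵇ q zero) then belowUntilᶠ x (q zero) m (q ∘ suc) else 0)
  ≡⟨ cong (λ t → if (x <ᵇ q zero) ∧ (c ≤ᵇ q zero) then t else 0) (belowUntilᶠ-tabulate x (q zero) m (q ∘ suc)) ⟩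
    (if (x <ᵇ q zero) ∧ (c ≤ᵇ q zero) then belowUntil x (q zero) (tabulate (q ∘ suc)) else 0)
  ∎)
  (trans (sumᶠ-cong m λ j → sumᶠ-cong m λ k →
            cong (λ b → 𝟙 ((j <ᶠ k) ∧ (q (suc k) <ᵇ x) ∧ (x <ᵇ q (suc j)) ∧ b))
                 (≤ᵇ-∧-not-<ᵇ c (q (suc j)) (q zero) _))
         (T₂-fromᶠ-tabulate x (c ⊔ q zero) m (q ∘ suc)))

S₁ᶠ-suc : ∀ m p → S₁ᶠ (suc m) p ≡ S₁-fromᶠ (p zero) (p zero) m (p ∘ suc) + S₁ᶠ m (p ∘ suc)
S₁ᶠ-suc m p = cong (_+ S₁ᶠ m (p ∘ suc))
  (sumᶠ-cong m λ j → cong 𝟙 (sym (<ᵇ-∧-≤ᵇ (p zero) (p (suc j)) _)))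

T₂ᶠ-suc : ∀ m p → T₂ᶠ (suc m) p ≡ T₂-fromᶠ (p zero) (p zero) m (p ∘ suc) + T₂ᶠ m (p ∘ suc)
T₂ᶠ-suc m p = begin
    T₂ᶠ (suc m) p
  ≡⟨⟩
    (sumᶠ m (λ _ → 0) + sumᶠ m (λ j → sumᶠ m (λ k → 𝟙 (headTriple j k))))
      + sumᶠ m (λ i → sumᶠ m (λ _ → 0)
                      + sumᶠ m (λ j → 𝟙 ((i <ᶠ j) ∧ false) + sumᶠ m (λ k → 𝟙 (tailTriple i j k))))
  ≡⟨ cong₂ _+_
       (trans (cong (_+ sumᶠ m (λ j → sumᶠ m (λ k → 𝟙 (headTriple j k)))) (sumᶠ-zero m))
              (sumᶠ-cong m λ j → sumᶠ-cong m λ k →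
          cong (λ b → 𝟙 ((j <ᶠ k) ∧ (q k <ᵇ x) ∧ b)) (sym (<ᵇ-∧-≤ᵇ x (q j) _))))
       (sumᶠ-cong m λ i →
          trans (cong (_+ sumᶠ m (λ j → 𝟙 ((i <ᶠ j) ∧ false) + sumᶠ m (λ k → 𝟙 (tailTriple i j k))))
                      (sumᶠ-zero m))
                (sumᶠ-cong m λ j → cong (λ b → 𝟙 b + sumᶠ m (λ k → 𝟙 (tailTriple i j k))) (∧-zeroʳ (i <ᶠ j)))) ⟩
    T₂-fromᶠ x x m q + T₂ᶠ m q
  ∎
  where
  x = p zero
  q = p ∘ suc
  headTriple : Fin m → Fin m → Bool
  headTriple j k = (j <ᶠ k) ∧ (q k <ᵇ x) ∧ (x <ᵇ q j) ∧
    allᶠ m λ l → not ((l <ᶠ k) ∧ not (does (l Fin.≟ j)) ∧ (q j <ᵇ q l))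
  tailTriple : Fin m → Fin m → Fin m → Bool
  tailTriple i j k = (i <ᶠ j) ∧ (j <ᶠ k) ∧ (q k <ᵇ q i) ∧ (q i <ᵇ q j) ∧
    allᶠ m λ l → not ((i <ᶠ l) ∧ (l <ᶠ k) ∧ not (does (l Fin.≟ j)) ∧ (q j <ᵇ q l))

below-tabulate : ∀ x m q → below x (tabulate q) ≡ sumᶠ m (λ j → 𝟙 (q j <ᵇ x))
below-tabulate x m q = countᵇ-tabulate m (_<ᵇ x) q

invᶠ≡invᴸ : ∀ m p → invᶠ m p ≡ invᴸ (tabulate p)
invᶠ≡invᴸ zero    p = refl
invᶠ≡invᴸ (suc m) p = cong₂ _+_ (sym (below-tabulate (p zero) m (p ∘ suc))) (invᶠ≡invᴸ m (p ∘ suc))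

S₁ᶠ+T₂ᶠ≡mixᴸ : ∀ m p → S₁ᶠ m p + T₂ᶠ m p ≡ mixᴸ (tabulate p)
S₁ᶠ+T₂ᶠ≡mixᴸ zero    p = refl
S₁ᶠ+T₂ᶠ≡mixᴸ (suc m) p = begin
    S₁ᶠ (suc m) p + T₂ᶠ (suc m) p
  ≡⟨ cong₂ _+_ (S₁ᶠ-suc m p) (T₂ᶠ-suc m p) ⟩
    (S₁-fromᶠ x x m q + S₁ᶠ m q) + (T₂-fromᶠ x x m q + T₂ᶠ m q)
  ≡⟨ interchange (S₁-fromᶠ x x m q) (S₁ᶠ m q) (T₂-fromᶠ x x m q) (T₂ᶠ m q) ⟩
    (S₁-fromᶠ x x m q + T₂-fromᶠ x x m q) + (S₁ᶠ m q + T₂ᶠ m q)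
  ≡⟨ cong₂ _+_ (cong₂ _+_ (S₁-fromᶠ-tabulate x x m q) (T₂-fromᶠ-tabulate x x m q)) (S₁ᶠ+T₂ᶠ≡mixᴸ m q) ⟩
    mixᴸ (tabulate p)
  ∎
  where
  x = p zero
  q = p ∘ suc

toWord : ∀ {n} → Perm n → List ℕ
toWord π = tabulate (values π)

mix′≡mixᴸ : ∀ {n} (π : Perm n) → mix′ π ≡ mixᴸ (toWord π)
mix′≡mixᴸ {n} π = trans (cong₂ _+_ (S₁≡S₁ᶠ π) (T₂≡T₂ᶠ π)) (S₁ᶠ+T₂ᶠ≡mixᴸ n (values π))

inv≡invᴸ : ∀ {n} (π : Perm n) → inv π ≡ invᴸ (toWord π)
inv≡invᴸ {n} π = trans (inv≡invᶠ π) (invᶠ≡invᴸ n (values π))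

invBetween : List ℕ → List ℕ → ℕ
invBetween []      β = 0
invBetween (x ∷ α) β = below x β + invBetween α β

module OrderEmbedding (e : ℕ → ℕ) (e-mono : ∀ {a b} → a < b → e a < e b) where

  <ᵇ-map : ∀ a b → (e a <ᵇ e b) ≡ (a <ᵇ b)
  <ᵇ-map a b with <-≤-connex a b
  ... | inj₁ a<b = trans (<ᵇ-true (e-mono a<b)) (sym (<ᵇ-true a<b))
  ... | inj₂ b≤a with m≤n⇒m<n∨m≡n b≤a
  ...   | inj₁ b<a  = trans (<ᵇ-false (<⇒≤ (e-mono b<a))) (sym (<ᵇ-false b≤a))
  ...   | inj₂ refl = trans (<ᵇ-false (≤-refl {e a})) (sym (<ᵇ-false b≤a))

  ≤ᵇ-map : ∀ a b → (e a ≤ᵇ e b) ≡ (a ≤ᵇ b)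
  ≤ᵇ-map a b = trans (sym (not-<ᵇ (e b) (e a))) (trans (cong not (<ᵇ-map b a)) (not-<ᵇ b a))

  ⊔-map : ∀ a b → e (a ⊔ b) ≡ e a ⊔ e b
  ⊔-map a b with ≤-<-connex a b
  ... | inj₂ b<a = trans (cong e (m≥n⇒m⊔n≡m (<⇒≤ b<a))) (sym (m≥n⇒m⊔n≡m (<⇒≤ (e-mono b<a))))
  ... | inj₁ a≤b with m≤n⇒m<n∨m≡n a≤b
  ...   | inj₁ a<b  = trans (cong e (m≤n⇒m⊔n≡n a≤b)) (sym (m≤n⇒m⊔n≡n (<⇒≤ (e-mono a<b))))
  ...   | inj₂ refl = trans (cong e (⊔-idem a)) (sym (⊔-idem (e a)))

  below-map : ∀ x w → below (e x) (map e w) ≡ below x w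
  below-map x []      = refl
  below-map x (y ∷ w) = cong₂ _+_ (cong 𝟙 (<ᵇ-map y x)) (below-map x w)

  S₁-from-map : ∀ x c w → S₁-from (e x) (e c) (map e w) ≡ S₁-from x c w
  S₁-from-map x c []      = refl
  S₁-from-map x c (y ∷ w) = cong₂ _+_ (cong 𝟙 (cong₂ _∧_ (<ᵇ-map x y) (≤ᵇ-map c y)))
    (trans (cong (λ t → S₁-from (e x) t (map e w)) (sym (⊔-map c y))) (S₁-from-map x (c ⊔ y) w))

  belowUntil-map : ∀ x c w → belowUntil (e x) (e c) (map e w) ≡ belowUntil x c w
  belowUntil-map x c []      = refl
  belowUntil-map x c (z ∷ w) = cong₂ _+_ (cong 𝟙 (<ᵇ-map z x))
    (cong₂ (λ b t → if b then t else 0) (≤ᵇ-map z c) (belowUntil-map x c w))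

  T₂-from-map : ∀ x c w → T₂-from (e x) (e c) (map e w) ≡ T₂-from x c w
  T₂-from-map x c []      = refl
  T₂-from-map x c (y ∷ w) = cong₂ _+_
    (cong₂ (λ b t → if b then t else 0) (cong₂ _∧_ (<ᵇ-map x y) (≤ᵇ-map c y)) (belowUntil-map x y w))
    (trans (cong (λ t → T₂-from (e x) t (map e w)) (sym (⊔-map c y))) (T₂-from-map x (c ⊔ y) w))

  mixᴸ-map : ∀ w → mixᴸ (map e w) ≡ mixᴸ w
  mixᴸ-map []      = refl
  mixᴸ-map (x ∷ w) = cong₂ _+_ (cong₂ _+_ (S₁-from-map x x w) (T₂-from-map x x w)) (mixᴸ-map w)

  invᴸ-map : ∀ w → invᴸ (map e w) ≡ invᴸ w
  invᴸ-map []      = refl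
  invᴸ-map (x ∷ w) = cong₂ _+_ (below-map x w) (invᴸ-map w)

  invBetween-map : ∀ α β → invBetween (map e α) (map e β) ≡ invBetween α β
  invBetween-map []      β = refl
  invBetween-map (x ∷ α) β = cong₂ _+_ (below-map x β) (invBetween-map α β)

-- Splitting a word at its largest letter

S₁-from-≡0 : ∀ x c β → All (_< c) β → S₁-from x c β ≡ 0
S₁-from-≡0 x c []      []       = refl
S₁-from-≡0 x c (y ∷ β) (y<c ∷ β<c)
  rewrite ≤ᵇ-false y<c | ∧-zeroʳ (x <ᵇ y) | m≥n⇒m⊔n≡m (<⇒≤ y<c) = S₁-from-≡0 x c β β<c

T₂-from-≡0 : ∀ x c β → All (_< c) β → T₂-from x c β ≡ 0
T₂-from-≡0 x c []      []       = refl
T₂-from-≡0 x c (y ∷ β) (y<c ∷ β<c)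
  rewrite ≤ᵇ-false y<c | ∧-zeroʳ (x <ᵇ y) | m≥n⇒m⊔n≡m (<⇒≤ y<c) = T₂-from-≡0 x c β β<c

belowUntil-≡below : ∀ x c β → All (_< c) β → belowUntil x c β ≡ below x β
belowUntil-≡below x c []      []       = refl
belowUntil-≡below x c (z ∷ β) (z<c ∷ β<c) rewrite ≤ᵇ-true (<⇒≤ z<c) =
  cong (𝟙 (z <ᵇ x) +_) (belowUntil-≡below x c β β<c)

below-≡length : ∀ M β → All (_< M) β → below M β ≡ length β
below-≡length M []      []       = refl
below-≡length M (y ∷ β) (y<M ∷ β<M) rewrite <ᵇ-true y<M = cong suc (below-≡length M β β<M)

S₁-from-++-max : ∀ x c M α β → x < M → c ≤ M → All (_< M) α → All (_< M) β →
                 S₁-from x c (α ++ M ∷ β) ≡ S₁-from x c α + 1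
S₁-from-++-max x c M [] β x<M c≤M [] β<M
  rewrite <ᵇ-true x<M | ≤ᵇ-true c≤M | m≤n⇒m⊔n≡n c≤M = cong suc (S₁-from-≡0 x M β β<M)
S₁-from-++-max x c M (y ∷ α) β x<M c≤M (y<M ∷ α<M) β<M =
  trans (cong (𝟙 ((x <ᵇ y) ∧ (c ≤ᵇ y)) +_)
              (S₁-from-++-max x (c ⊔ y) M α β x<M (⊔-lub c≤M (<⇒≤ y<M)) α<M β<M))
        (sym (+-assoc (𝟙 ((x <ᵇ y) ∧ (c ≤ᵇ y))) _ 1))

belowUntil-++-max : ∀ x c M α β → x ≤ M → c < M → belowUntil x c (α ++ M ∷ β) ≡ belowUntil x c α
belowUntil-++-max x c M []      β x≤M c<M rewrite <ᵇ-false x≤M | ≤ᵇ-false c<M = refl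
belowUntil-++-max x c M (z ∷ α) β x≤M c<M =
  cong (λ t → 𝟙 (z <ᵇ x) + (if z ≤ᵇ c then t else 0)) (belowUntil-++-max x c M α β x≤M c<M)

T₂-from-++-max : ∀ x c M α β → x < M → c ≤ M → All (_< M) α → All (_< M) β →
                 T₂-from x c (α ++ M ∷ β) ≡ T₂-from x c α + below x β
T₂-from-++-max x c M [] β x<M c≤M [] β<M
  rewrite <ᵇ-true x<M | ≤ᵇ-true c≤M | m≤n⇒m⊔n≡n c≤M =
  trans (cong₂ _+_ (belowUntil-≡below x M β β<M) (T₂-from-≡0 x M β β<M)) (+-identityʳ _)
T₂-from-++-max x c M (y ∷ α) β x<M c≤M (y<M ∷ α<M) β<M =
  trans (cong₂ _+_ (cong (λ t → if (x <ᵇ y) ∧ (c ≤ᵇ y) then t else 0)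
                         (belowUntil-++-max x y M α β (<⇒≤ x<M) y<M))
                   (T₂-from-++-max x (c ⊔ y) M α β x<M (⊔-lub c≤M (<⇒≤ y<M)) α<M β<M))
        (sym (+-assoc (if (x <ᵇ y) ∧ (c ≤ᵇ y) then belowUntil x y α else 0) _ _))

-- Each letter x of α gains the S₁-pair (x, M) and the T₂-triples (x, M, b) with b ∈ β below x,
-- while M itself heads no pair or triple.
mixᴸ-++-max : ∀ M α β → All (_< M) α → All (_< M) β →
              mixᴸ (α ++ M ∷ β) ≡ mixᴸ α + mixᴸ β + length α + invBetween α β
mixᴸ-++-max M [] β [] β<M =
  trans (cong₂ (λ a b → a + b + mixᴸ β) (S₁-from-≡0 M M β β<M) (T₂-from-≡0 M M β β<M))
        (sym (trans (+-identityʳ _) (+-identityʳ _)))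
mixᴸ-++-max M (x ∷ α) β (x<M ∷ α<M) β<M =
  trans (cong₂ _+_ (cong₂ _+_ (S₁-from-++-max x x M α β x<M (<⇒≤ x<M) α<M β<M)
                              (T₂-from-++-max x x M α β x<M (<⇒≤ x<M) α<M β<M))
                   (mixᴸ-++-max M α β α<M β<M))
        (rearrange (S₁-from x x α) (T₂-from x x α) (below x β) (mixᴸ α) (mixᴸ β) (length α) (invBetween α β))
  where
  rearrange : ∀ a b c d e f g → (a + 1) + (b + c) + (d + e + f + g) ≡ (a + b + d) + e + suc f + (c + g)
  rearrange = solve-∀

invᴸ-++-max : ∀ M α β → All (_< M) α → All (_< M) β →
              invᴸ (α ++ M ∷ β) ≡ invᴸ α + invᴸ β + length β + invBetween α β
invᴸ-++-max M [] β [] β<M =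
  trans (cong (_+ invᴸ β) (below-≡length M β β<M)) (trans (+-comm (length β) (invᴸ β)) (sym (+-identityʳ _)))
invᴸ-++-max M (x ∷ α) β (x<M ∷ α<M) β<M =
  trans (cong₂ _+_ (trans (countᵇ-++ (_<ᵇ x) α (M ∷ β))
                          (cong (λ t → below x α + (𝟙 t + below x β)) (<ᵇ-false (<⇒≤ x<M))))
                   (invᴸ-++-max M α β α<M β<M))
        (rearrange (below x α) (below x β) (invᴸ α) (invᴸ β) (length β) (invBetween α β))
  where
  rearrange : ∀ a b c d e f → (a + b) + (c + d + e + f) ≡ (a + c) + d + e + (b + f)
  rearrange = solve-∀

-- Shuffles

map-upTo-suc : ∀ {A : Set} (f : ℕ → A) n → map f (upTo (suc n)) ≡ f 0 ∷ map (f ∘ suc) (upTo n)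
map-upTo-suc f n = cong (f 0 ∷_) (trans (map-applyUpTo suc f n) (sym (map-upTo (f ∘ suc) n)))

upTo-suc : ∀ n → upTo (suc n) ≡ 0 ∷ map suc (upTo n)
upTo-suc n = trans (sym (map-id (upTo (suc n)))) (map-upTo-suc id n)

#true : List Bool → ℕ
#true = countᵇ id

#false : List Bool → ℕ
#false s = #true (map not s)

trueIndex : List Bool → ℕ → ℕ
trueIndex []           i       = i
trueIndex (true ∷ s)   zero    = zero
trueIndex (true ∷ s)   (suc i) = suc (trueIndex s i)
trueIndex (false ∷ s)  i       = suc (trueIndex s i)

falseIndex : List Bool → ℕ → ℕ
falseIndex s = trueIndex (map not s)

trueIndices : List Bool → List ℕ
trueIndices []          = []
trueIndices (true ∷ s)  = 0 ∷ map suc (trueIndices s)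
trueIndices (false ∷ s) = map suc (trueIndices s)

falseIndices : List Bool → List ℕ
falseIndices s = trueIndices (map not s)

crossings : List Bool → ℕ
crossings []          = 0
crossings (true ∷ s)  = crossings s
crossings (false ∷ s) = #true s + crossings s

dual : List Bool → List Bool
dual s = reverse (map not s)

trueIndex-mono : ∀ s {i j} → i < j → trueIndex s i < trueIndex s j
trueIndex-mono []          i<j                   = i<j
trueIndex-mono (true ∷ s)  {zero}  {suc j} _     = s≤s z≤n
trueIndex-mono (true ∷ s)  {suc i} {suc j} (s≤s i<j) = s≤s (trueIndex-mono s i<j)
trueIndex-mono (false ∷ s) i<j                   = s≤s (trueIndex-mono s i<j)

trueIndex-< : ∀ s {i} → i < #true s → trueIndex s i < length s
trueIndex-< (true ∷ s)  {zero}  _         = s≤s z≤n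
trueIndex-< (true ∷ s)  {suc i} (s≤s i<n) = s≤s (trueIndex-< s i<n)
trueIndex-< (false ∷ s) i<n               = s≤s (trueIndex-< s i<n)

map-trueIndex-upTo : ∀ s → map (trueIndex s) (upTo (#true s)) ≡ trueIndices s
map-trueIndex-upTo []          = refl
map-trueIndex-upTo (true ∷ s)  = begin
  map (trueIndex (true ∷ s)) (upTo (suc (#true s)))  ≡⟨ map-upTo-suc (trueIndex (true ∷ s)) (#true s) ⟩
  0 ∷ map (suc ∘ trueIndex s) (upTo (#true s))      ≡⟨ cong (0 ∷_) (map-∘ (upTo (#true s))) ⟩
  0 ∷ map suc (map (trueIndex s) (upTo (#true s)))  ≡⟨ cong (λ t → 0 ∷ map suc t) (map-trueIndex-upTo s) ⟩
  0 ∷ map suc (trueIndices s)                        ∎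
map-trueIndex-upTo (false ∷ s) = trans (map-∘ (upTo (#true s))) (cong (map suc) (map-trueIndex-upTo s))

trueIndices++falseIndices : ∀ s → trueIndices s ++ falseIndices s ↭ upTo (length s)
trueIndices++falseIndices []          = ↭-refl
trueIndices++falseIndices (b ∷ s) = ↭-trans (split b) (↭-reflexive (sym (upTo-suc (length s))))
  where
  shifted : map suc (trueIndices s) ++ map suc (falseIndices s) ↭ map suc (upTo (length s))
  shifted = ↭-trans (↭-reflexive (sym (map-++ suc (trueIndices s) (falseIndices s))))
                    (↭.map⁺ suc (trueIndices++falseIndices s))
  split : ∀ b → trueIndices (b ∷ s) ++ falseIndices (b ∷ s) ↭ 0 ∷ map suc (upTo (length s))
  split true  = ↭-prep 0 shifted
  split false = ↭-trans (↭.shift 0 (map suc (trueIndices s)) (map suc (falseIndices s))) (↭-prep 0 shifted)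

#true+#false : ∀ s → #true s + #false s ≡ length s
#true+#false []          = refl
#true+#false (true ∷ s)  = cong suc (#true+#false s)
#true+#false (false ∷ s) = trans (+-suc (#true s) (#false s)) (cong suc (#true+#false s))

length-trueIndices : ∀ s → length (trueIndices s) ≡ #true s
length-trueIndices []          = refl
length-trueIndices (true ∷ s)  = cong suc (trans (length-map suc (trueIndices s)) (length-trueIndices s))
length-trueIndices (false ∷ s) = trans (length-map suc (trueIndices s)) (length-trueIndices s)

below-zero : ∀ w → below 0 w ≡ 0
below-zero []      = refl
below-zero (_ ∷ w) = below-zero w

open OrderEmbedding suc s≤s using () renaming (below-map to below-map-suc; invBetween-map to invBetween-map-suc)

invBetween-suc-zero : ∀ α β → invBetween (map suc α) (0 ∷ map suc β) ≡ length α + invBetween α β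
invBetween-suc-zero []      β = refl
invBetween-suc-zero (x ∷ α) β = cong suc (trans (cong₂ _+_ (below-map-suc x β) (invBetween-suc-zero α β))
  (x∙yz≈y∙xz (below x β) (length α) (invBetween α β)))

invBetween-indices : ∀ s → invBetween (trueIndices s) (falseIndices s) ≡ crossings s
invBetween-indices []          = refl
invBetween-indices (true ∷ s)  =
  trans (cong (_+ invBetween (map suc (trueIndices s)) (map suc (falseIndices s))) (below-zero (map suc (falseIndices s))))
        (trans (invBetween-map-suc (trueIndices s) (falseIndices s)) (invBetween-indices s))
invBetween-indices (false ∷ s) =
  trans (invBetween-suc-zero (trueIndices s) (falseIndices s))
        (cong₂ _+_ (length-trueIndices s) (invBetween-indices s))

map-not-involutive : ∀ s → map not (map not s) ≡ s
map-not-involutive s = trans (sym (map-∘ s)) (trans (map-cong not-involutive s) (map-id s))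

#true-reverse : ∀ s → #true (reverse s) ≡ #true s
#true-reverse s = countᵇ-↭ id (↭.↭-reverse s)

#true-dual : ∀ s → #true (dual s) ≡ #false s
#true-dual s = #true-reverse (map not s)

#false-dual : ∀ s → #false (dual s) ≡ #true s
#false-dual s = begin
  #true (map not (reverse (map not s)))  ≡⟨ cong #true (reverse-map not (map not s)) ⟩
  #true (reverse (map not (map not s)))  ≡⟨ #true-reverse (map not (map not s)) ⟩
  #true (map not (map not s))            ≡⟨ cong #true (map-not-involutive s) ⟩
  #true s                                ∎

dual-involutive : ∀ s → dual (dual s) ≡ s
dual-involutive s = begin
  reverse (map not (reverse (map not s)))  ≡⟨ cong reverse (reverse-map not (map not s)) ⟩
  reverse (reverse (map not (map not s)))  ≡⟨ reverse-involutive _ ⟩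
  map not (map not s)                      ≡⟨ map-not-involutive s ⟩
  s                                        ∎

length-dual : ∀ s → length (dual s) ≡ length s
length-dual s = trans (length-reverse (map not s)) (length-map not s)

crossings-∷ʳ-true : ∀ s → crossings (s ∷ʳ true) ≡ crossings s + #false s
crossings-∷ʳ-true []          = refl
crossings-∷ʳ-true (true ∷ s)  = crossings-∷ʳ-true s
crossings-∷ʳ-true (false ∷ s) =
  trans (cong₂ _+_ (countᵇ-++ id s [ true ]) (crossings-∷ʳ-true s))
        (rearrange (#true s) (crossings s) (#false s))
  where
  rearrange : ∀ a b c → (a + 1) + (b + c) ≡ (a + b) + suc c
  rearrange = solve-∀

crossings-∷ʳ-false : ∀ s → crossings (s ∷ʳ false) ≡ crossings s
crossings-∷ʳ-false []          = refl
crossings-∷ʳ-false (true ∷ s)  = crossings-∷ʳ-false s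
crossings-∷ʳ-false (false ∷ s) =
  cong₂ _+_ (trans (countᵇ-++ id s [ false ]) (+-identityʳ _)) (crossings-∷ʳ-false s)

crossings-dual : ∀ s → crossings (dual s) ≡ crossings s
crossings-dual []          = refl
crossings-dual (true ∷ s)  rewrite unfold-reverse false (map not s) =
  trans (crossings-∷ʳ-false (dual s)) (crossings-dual s)
crossings-dual (false ∷ s) rewrite unfold-reverse true (map not s) =
  trans (crossings-∷ʳ-true (dual s))
        (trans (cong₂ _+_ (crossings-dual s) (#false-dual s)) (+-comm (crossings s) (#true s)))

infix 4 _∈ᵇ_

_∈ᵇ_ : ℕ → List ℕ → Bool
v ∈ᵇ []       = false
v ∈ᵇ (x ∷ xs) = (v ≡ᵇ x) ∨ (v ∈ᵇ xs)

∈ᵇ⇒∈ : ∀ v xs → (v ∈ᵇ xs) ≡ true → v ∈ xs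
∈ᵇ⇒∈ v (x ∷ xs) h with v ≡ᵇ x in eq
... | true  = here (≡ᵇ⇒≡ v x (Equivalence.from T-≡ eq))
... | false = there (∈ᵇ⇒∈ v xs h)

∈⇒∈ᵇ : ∀ {v xs} → v ∈ xs → (v ∈ᵇ xs) ≡ true
∈⇒∈ᵇ {v} (here refl) rewrite ≡ᵇ-refl v = refl
∈⇒∈ᵇ {v} {x ∷ xs} (there p) rewrite ∈⇒∈ᵇ p = ∨-zeroʳ (v ≡ᵇ x)

∉⇒∈ᵇ : ∀ {v xs} → v ∉ xs → (v ∈ᵇ xs) ≡ false
∉⇒∈ᵇ {v} {xs} v∉xs with v ∈ᵇ xs in eq
... | true  = ⊥-elim (v∉xs (∈ᵇ⇒∈ v xs eq))
... | false = refl

∈ᵇ-↭ : ∀ v {xs ys} → xs ↭ ys → (v ∈ᵇ xs) ≡ (v ∈ᵇ ys)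
∈ᵇ-↭ v {xs} {ys} p with v ∈ᵇ xs in eq
... | true  = sym (∈⇒∈ᵇ (↭.∈-resp-↭ p (∈ᵇ⇒∈ v xs eq)))
... | false = sym (∉⇒∈ᵇ (λ v∈ys → true≢false (trans (sym (∈⇒∈ᵇ (↭.∈-resp-↭ (↭-sym p) v∈ys))) eq)))

suc-∈ᵇ-map-suc : ∀ v xs → (suc v ∈ᵇ map suc xs) ≡ (v ∈ᵇ xs)
suc-∈ᵇ-map-suc v []       = refl
suc-∈ᵇ-map-suc v (x ∷ xs) = cong ((v ≡ᵇ x) ∨_) (suc-∈ᵇ-map-suc v xs)

zero-∈ᵇ-map-suc : ∀ xs → (0 ∈ᵇ map suc xs) ≡ false
zero-∈ᵇ-map-suc []       = refl
zero-∈ᵇ-map-suc (x ∷ xs) = zero-∈ᵇ-map-suc xs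

invBetween-↭ˡ : ∀ {α α′} β → α ↭ α′ → invBetween α β ≡ invBetween α′ β
invBetween-↭ˡ β _↭_.refl        = refl
invBetween-↭ˡ β (_↭_.prep x p)  = cong (below x β +_) (invBetween-↭ˡ β p)
invBetween-↭ˡ β (_↭_.swap {ys = ys} x y p) =
  trans (cong (λ t → below x β + (below y β + t)) (invBetween-↭ˡ β p))
        (x∙yz≈y∙xz (below x β) (below y β) (invBetween ys β))
invBetween-↭ˡ β (_↭_.trans p q) = trans (invBetween-↭ˡ β p) (invBetween-↭ˡ β q)

invBetween-↭ʳ : ∀ α {β β′} → β ↭ β′ → invBetween α β ≡ invBetween α β′
invBetween-↭ʳ []      p = refl
invBetween-↭ʳ (x ∷ α) p = cong₂ _+_ (countᵇ-↭ (_<ᵇ x) p) (invBetween-↭ʳ α p)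

below-upTo : ∀ i a → i ≤ a → below i (upTo a) ≡ i
below-upTo zero    a       _         = below-zero (upTo a)
below-upTo (suc i) (suc a) (s≤s i≤a) = begin
  below (suc i) (upTo (suc a))          ≡⟨ cong (below (suc i)) (upTo-suc a) ⟩
  suc (below (suc i) (map suc (upTo a))) ≡⟨ cong suc (below-map-suc i (upTo a)) ⟩
  suc (below i (upTo a))                ≡⟨ cong suc (below-upTo i a i≤a) ⟩
  suc i                                 ∎

Unique-↭ : ∀ {xs ys : List ℕ} → xs ↭ ys → Unique xs → Unique ys
Unique-↭ p = Unique-resp-↭ (↭⇒↭ₛ p)

Unique-++⁻ : ∀ (xs : List ℕ) {ys} → Unique (xs ++ ys) → Unique xs × Unique ys × (∀ {x} → x ∈ xs → x ∉ ys)
Unique-++⁻ []       u       = [] , u , λ ()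
Unique-++⁻ (x ∷ xs) (x∉ ∷ u) with Unique-++⁻ xs u
... | uxs , uys , disjoint = All.++⁻ˡ xs x∉ ∷ uxs , uys , disjoint′
  where
  disjoint′ : ∀ {z} → z ∈ x ∷ xs → z ∉ _
  disjoint′ (here refl) z∈ys = All.lookup (All.++⁻ʳ xs x∉) z∈ys refl
  disjoint′ (there z∈xs)     = disjoint z∈xs

bitAt : List Bool → ℕ → Bool
bitAt []      v       = false
bitAt (b ∷ s) zero    = b
bitAt (b ∷ s) (suc v) = bitAt s v

∈ᵇ-trueIndices : ∀ s v → (v ∈ᵇ trueIndices s) ≡ bitAt s v
∈ᵇ-trueIndices []          v       = refl
∈ᵇ-trueIndices (true ∷ s)  zero    = refl
∈ᵇ-trueIndices (true ∷ s)  (suc v) = trans (suc-∈ᵇ-map-suc v (trueIndices s)) (∈ᵇ-trueIndices s v)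
∈ᵇ-trueIndices (false ∷ s) zero    = zero-∈ᵇ-map-suc (trueIndices s)
∈ᵇ-trueIndices (false ∷ s) (suc v) = trans (suc-∈ᵇ-map-suc v (trueIndices s)) (∈ᵇ-trueIndices s v)

map-bitAt-upTo : ∀ s → map (bitAt s) (upTo (length s)) ≡ s
map-bitAt-upTo []      = refl
map-bitAt-upTo (b ∷ s) = trans (map-upTo-suc (bitAt (b ∷ s)) (length s)) (cong (b ∷_) (map-bitAt-upTo s))

bitAt-map-upTo : ∀ (f : ℕ → Bool) n x → x < n → bitAt (map f (upTo n)) x ≡ f x
bitAt-map-upTo f (suc n) zero    _         = cong (λ t → bitAt t 0) (map-upTo-suc f n)
bitAt-map-upTo f (suc n) (suc x) (s≤s x<n) =
  trans (cong (λ t → bitAt t (suc x)) (map-upTo-suc f n)) (bitAt-map-upTo (f ∘ suc) n x x<n)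

bitAt-map-upTo-≥ : ∀ (f : ℕ → Bool) n x → n ≤ x → bitAt (map f (upTo n)) x ≡ false
bitAt-map-upTo-≥ f zero    x       _         = refl
bitAt-map-upTo-≥ f (suc n) (suc x) (s≤s n≤x) =
  trans (cong (λ t → bitAt t (suc x)) (map-upTo-suc f n)) (bitAt-map-upTo-≥ (f ∘ suc) n x n≤x)

∈-trueIndices⁻ : ∀ s {x} → x ∈ trueIndices s → bitAt s x ≡ true
∈-trueIndices⁻ s {x} x∈ = trans (sym (∈ᵇ-trueIndices s x)) (∈⇒∈ᵇ x∈)

∈-trueIndices⁺ : ∀ s {x} → bitAt s x ≡ true → x ∈ trueIndices s
∈-trueIndices⁺ s {x} h = ∈ᵇ⇒∈ x (trueIndices s) (trans (∈ᵇ-trueIndices s x) h)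

Unique-trueIndices : ∀ s → Unique (trueIndices s)
Unique-trueIndices s =
  proj₁ (Unique-++⁻ (trueIndices s) (Unique-↭ (↭-sym (trueIndices++falseIndices s)) (Unique.upTo⁺ (length s))))

-- Standardisation

standardize : List ℕ → List ℕ
standardize γ = map (λ x → below x γ) γ

shuffleOf : ℕ → List ℕ → List Bool
shuffleOf n γ = map (_∈ᵇ γ) (upTo n)

map-id-upTo : ∀ a (f : ℕ → ℕ) → (∀ i → i < a → f i ≡ i) → map f (upTo a) ≡ upTo a
map-id-upTo a f h = map-id-local (All.tabulate (λ i∈ → h _ (∈-upTo⁻ i∈)))

below-trueIndex : ∀ s i → i < #true s → below (trueIndex s i) (trueIndices s) ≡ i
below-trueIndex s i i<k = begin
  below (trueIndex s i) (trueIndices s)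
    ≡⟨ cong (below (trueIndex s i)) (sym (map-trueIndex-upTo s)) ⟩
  below (trueIndex s i) (map (trueIndex s) (upTo (#true s)))
    ≡⟨ OrderEmbedding.below-map (trueIndex s) (trueIndex-mono s) i (upTo (#true s)) ⟩
  below i (upTo (#true s))
    ≡⟨ below-upTo i (#true s) (<⇒≤ i<k) ⟩
  i ∎

standardize-↭ : ∀ s {γ} → γ ↭ trueIndices s → standardize γ ↭ upTo (#true s)
standardize-↭ s {γ} γ↭ =
  ↭-trans (↭-reflexive (map-cong (λ x → countᵇ-↭ (_<ᵇ x) γ↭) γ))
  (↭-trans (↭.map⁺ (λ x → below x (trueIndices s)) γ↭)
  (↭-reflexive (trans (cong (map (λ x → below x (trueIndices s))) (sym (map-trueIndex-upTo s)))
               (trans (sym (map-∘ (upTo (#true s))))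
                      (map-id-upTo (#true s) _ (below-trueIndex s))))))

map-trueIndex-standardize : ∀ s {γ} → γ ↭ trueIndices s → map (trueIndex s) (standardize γ) ≡ γ
map-trueIndex-standardize s {γ} γ↭ = trans (sym (map-∘ γ)) (map-id-local (All.tabulate fixed))
  where
  fixed : ∀ {x} → x ∈ γ → trueIndex s (below x γ) ≡ x
  fixed x∈γ with ∈-map⁻ (trueIndex s) (subst (_ ∈_) (sym (map-trueIndex-upTo s)) (↭.∈-resp-↭ γ↭ x∈γ))
  ... | i , i∈ , refl =
    cong (trueIndex s) (trans (countᵇ-↭ (_<ᵇ trueIndex s i) γ↭) (below-trueIndex s i (∈-upTo⁻ i∈)))

standardize-map : ∀ (e : ℕ → ℕ) (e-mono : ∀ {a b} → a < b → e a < e b) a {u} →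
                  u ↭ upTo a → standardize (map e u) ≡ u
standardize-map e e-mono a {u} u↭ =
  trans (sym (map-∘ u))
  (trans (map-cong (λ i → OrderEmbedding.below-map e e-mono i u) u)
  (map-id-local (All.tabulate λ {i} i∈u →
     trans (countᵇ-↭ (_<ᵇ i) u↭) (below-upTo i a (<⇒≤ (∈-upTo⁻ (↭.∈-resp-↭ u↭ i∈u)))))))

map-trueIndex-↭ : ∀ s {u} → u ↭ upTo (#true s) → map (trueIndex s) u ↭ trueIndices s
map-trueIndex-↭ s u↭ = ↭-trans (↭.map⁺ (trueIndex s) u↭) (↭-reflexive (map-trueIndex-upTo s))

shuffleOf-map-trueIndex : ∀ s {u} → u ↭ upTo (#true s) → shuffleOf (length s) (map (trueIndex s) u) ≡ s
shuffleOf-map-trueIndex s u↭ =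
  trans (map-cong (λ v → trans (∈ᵇ-↭ v (map-trueIndex-↭ s u↭)) (∈ᵇ-trueIndices s v)) (upTo (length s)))
        (map-bitAt-upTo s)

breakAt : ℕ → List ℕ → List ℕ × List ℕ
breakAt n []      = [] , []
breakAt n (x ∷ w) = if x ≡ᵇ n then ([] , w) else (x ∷ proj₁ (breakAt n w) , proj₂ (breakAt n w))

breakAt-++ : ∀ n α β → All (_< n) α → breakAt n (α ++ n ∷ β) ≡ (α , β)
breakAt-++ n []      β []          rewrite ≡ᵇ-refl n = refl
breakAt-++ n (x ∷ α) β (x<n ∷ α<n) with x ≡ᵇ n in eq
... | true  = ⊥-elim (<⇒≢ x<n (≡ᵇ⇒≡ x n (Equivalence.from T-≡ eq)))
... | false rewrite breakAt-++ n α β α<n = refl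

breakAt-∈ : ∀ n w → n ∈ w → w ≡ proj₁ (breakAt n w) ++ n ∷ proj₂ (breakAt n w)
breakAt-∈ n (x ∷ w) n∈ with x ≡ᵇ n in eq | n∈
... | true  | _            rewrite ≡ᵇ⇒≡ x n (Equivalence.from T-≡ eq) = refl
... | false | here refl    = ⊥-elim (true≢false (trans (sym (≡ᵇ-refl x)) eq))
... | false | there n∈w    = cong (x ∷_) (breakAt-∈ n w n∈w)

-- A permutation word of 0, …, n is α ++ n ∷ β, and α, β are determined by the shuffle
-- recording which values lie in α together with the standardisations of α and β.

module MaxDecomposition (n : ℕ) {w : List ℕ} (w↭ : w ↭ upTo (suc n)) where

  α β : List ℕ
  α = proj₁ (breakAt n w)
  β = proj₂ (breakAt n w)

  s : List Bool
  s = shuffleOf n α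

  w≡α++n∷β : w ≡ α ++ n ∷ β
  w≡α++n∷β = breakAt-∈ n w (↭.∈-resp-↭ (↭-sym w↭) (∈-upTo⁺ ≤-refl))

  private
    unique : Unique (α ++ n ∷ β)
    unique = subst Unique w≡α++n∷β (Unique-↭ (↭-sym w↭) (Unique.upTo⁺ (suc n)))

    α-unique : Unique α
    α-unique = proj₁ (Unique-++⁻ α unique)

    n∉β×β-unique : All (n ≢_) β × Unique β
    n∉β×β-unique with proj₁ (proj₂ (Unique-++⁻ α unique))
    ... | n∉β ∷ uβ = n∉β , uβ

    disjoint : ∀ {x} → x ∈ α → x ∉ n ∷ β
    disjoint = proj₂ (proj₂ (Unique-++⁻ α unique))

    ≤n : ∀ {x} → x ∈ α ++ n ∷ β → x ≤ n
    ≤n x∈ = s≤s⁻¹ (∈-upTo⁻ (↭.∈-resp-↭ w↭ (subst (_ ∈_) (sym w≡α++n∷β) x∈)))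

    bitAt-s : ∀ {x} → x < n → bitAt s x ≡ (x ∈ᵇ α)
    bitAt-s = bitAt-map-upTo (_∈ᵇ α) n _

    bitAt-not-s : ∀ {x} → x < n → bitAt (map not s) x ≡ not (x ∈ᵇ α)
    bitAt-not-s x<n = trans (cong (λ t → bitAt t _) (sym (map-∘ (upTo n)))) (bitAt-map-upTo (not ∘ (_∈ᵇ α)) n _ x<n)

    ≥n⇒bitAt-not-s : ∀ {x} → n ≤ x → bitAt (map not s) x ≡ false
    ≥n⇒bitAt-not-s n≤x = trans (cong (λ t → bitAt t _) (sym (map-∘ (upTo n)))) (bitAt-map-upTo-≥ (not ∘ (_∈ᵇ α)) n _ n≤x)

  α<n : All (_< n) α
  α<n = All.tabulate λ x∈α → ≤∧≢⇒< (≤n (∈-++⁺ˡ x∈α)) (λ x≡n → disjoint x∈α (here x≡n))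

  β<n : All (_< n) β
  β<n = All.tabulate λ x∈β → ≤∧≢⇒< (≤n (∈-++⁺ʳ α (there x∈β))) (λ x≡n → All.lookup (proj₁ n∉β×β-unique) x∈β (sym x≡n))

  length-s : length s ≡ n
  length-s = trans (length-map _ (upTo n)) (length-upTo n)

  α↭ : α ↭ trueIndices s
  α↭ = ∼bag⇒↭ (unique∧set⇒bag α-unique (Unique-trueIndices s) (mk⇔ to from))
    where
    to : ∀ {x} → x ∈ α → x ∈ trueIndices s
    to x∈α = ∈-trueIndices⁺ s (trans (bitAt-s (All.lookup α<n x∈α)) (∈⇒∈ᵇ x∈α))
    from : ∀ {x} → x ∈ trueIndices s → x ∈ α
    from {x} x∈ with <-≤-connex x n
    ... | inj₁ x<n = ∈ᵇ⇒∈ x α (trans (sym (bitAt-s x<n)) (∈-trueIndices⁻ s x∈))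
    ... | inj₂ n≤x = ⊥-elim (true≢false (trans (sym (∈-trueIndices⁻ s x∈)) (bitAt-map-upTo-≥ (_∈ᵇ α) n x n≤x)))

  β↭ : β ↭ falseIndices s
  β↭ = ∼bag⇒↭ (unique∧set⇒bag (proj₂ n∉β×β-unique) (Unique-trueIndices (map not s)) (mk⇔ to from))
    where
    to : ∀ {x} → x ∈ β → x ∈ falseIndices s
    to x∈β = ∈-trueIndices⁺ (map not s)
      (trans (bitAt-not-s (All.lookup β<n x∈β)) (cong not (∉⇒∈ᵇ (λ x∈α → disjoint x∈α (there x∈β)))))
    from : ∀ {x} → x ∈ falseIndices s → x ∈ β
    from {x} x∈ with <-≤-connex x n
    ... | inj₂ n≤x = ⊥-elim (true≢false (trans (sym (∈-trueIndices⁻ (map not s) x∈)) (≥n⇒bitAt-not-s n≤x)))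
    ... | inj₁ x<n with ∈-++⁻ α (subst (x ∈_) w≡α++n∷β (↭.∈-resp-↭ (↭-sym w↭) (∈-upTo⁺ (m≤n⇒m≤1+n x<n))))
    ...   | inj₂ (there x∈β) = x∈β
    ...   | inj₂ (here refl) = ⊥-elim (<-irrefl refl x<n)
    ...   | inj₁ x∈α = ⊥-elim (true≢false (begin
            true                 ≡⟨ sym (∈-trueIndices⁻ (map not s) x∈) ⟩
            bitAt (map not s) x  ≡⟨ bitAt-not-s x<n ⟩
            not (x ∈ᵇ α)         ≡⟨ cong not (∈⇒∈ᵇ x∈α) ⟩
            false                ∎))

module Assemble (n : ℕ) (s : List Bool) (length-s : length s ≡ n) {u v : List ℕ}
                (u↭ : u ↭ upTo (#true s)) (v↭ : v ↭ upTo (#false s)) where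

  α β : List ℕ
  α = map (trueIndex s) u
  β = map (falseIndex s) v

  α<n : All (_< n) α
  α<n = All.map⁺ (All.tabulate λ i∈u → subst (_ <_) length-s (trueIndex-< s (∈-upTo⁻ (↭.∈-resp-↭ u↭ i∈u))))

  β<n : All (_< n) β
  β<n = All.map⁺ (All.tabulate λ i∈v →
    subst (_ <_) (trans (length-map not s) length-s) (trueIndex-< (map not s) (∈-upTo⁻ (↭.∈-resp-↭ v↭ i∈v))))

  α++n∷β↭ : α ++ n ∷ β ↭ upTo (suc n)
  α++n∷β↭ =
    ↭-trans (↭.shift n α β)
    (↭-trans (↭-prep n (↭-trans (↭.++⁺ (map-trueIndex-↭ s u↭) (map-trueIndex-↭ (map not s) v↭))
                                (subst (λ k → trueIndices s ++ falseIndices s ↭ upTo k) length-s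
                                       (trueIndices++falseIndices s))))
    (↭-trans (↭.++-comm [ n ] (upTo n)) (↭-reflexive (upTo-∷ʳ n))))

  breakAt-α++n∷β : breakAt n (α ++ n ∷ β) ≡ (α , β)
  breakAt-α++n∷β = breakAt-++ n α β α<n

  shuffleOf-α : shuffleOf n α ≡ s
  shuffleOf-α = subst (λ k → shuffleOf k α ≡ s) length-s (shuffleOf-map-trueIndex s u↭)

  standardize-α : standardize α ≡ u
  standardize-α = standardize-map (trueIndex s) (trueIndex-mono s) (#true s) u↭

  standardize-β : standardize β ≡ v
  standardize-β = standardize-map (falseIndex s) (trueIndex-mono (map not s)) (#false s) v↭

-- The involution

merge : ℕ → List Bool → List ℕ → List ℕ → List ℕ
merge n s x y = map (trueIndex s) x ++ n ∷ map (falseIndex s) y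

glue : (List ℕ → List ℕ) → ℕ → List ℕ × List ℕ → List ℕ
glue rec n (α , β) = merge n (dual (shuffleOf n α)) (rec (standardize β)) (rec (standardize α))

-- Φ fuel w is the intended value whenever the length of w is at most fuel.
Φ : ℕ → List ℕ → List ℕ
Φ zero       w       = w
Φ (suc fuel) []      = []
Φ (suc fuel) (x ∷ w) = glue (Φ fuel) (length w) (breakAt (length w) (x ∷ w))

Φ-[] : ∀ fuel → Φ fuel [] ≡ []
Φ-[] zero       = refl
Φ-[] (suc fuel) = refl

Φ-unfold : ∀ fuel n w → length w ≡ suc n → Φ (suc fuel) w ≡ glue (Φ fuel) n (breakAt n w)
Φ-unfold fuel n (x ∷ w) refl = refl

length-↭upTo : ∀ {w m} → w ↭ upTo m → length w ≡ m
length-↭upTo {m = m} w↭ = trans (↭.↭-length w↭) (length-upTo m)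

-- Φ-↭ enters as a parameter so that Φ-↭ itself can be proved by opening this module.
module Step (fuel n : ℕ) (n≤fuel : n ≤ fuel) {w : List ℕ} (w↭ : w ↭ upTo (suc n))
            (Φ-↭ : ∀ m {x} → m ≤ fuel → x ↭ upTo m → Φ fuel x ↭ upTo m) where

  open MaxDecomposition n w↭ public

  u v : List ℕ
  u = standardize α
  v = standardize β

  u↭ : u ↭ upTo (#true s)
  u↭ = standardize-↭ s α↭

  v↭ : v ↭ upTo (#false s)
  v↭ = standardize-↭ (map not s) β↭

  #true≤fuel : #true s ≤ fuel
  #true≤fuel = ≤-trans (m≤m+n (#true s) (#false s)) (≤-trans (≤-reflexive (trans (#true+#false s) length-s)) n≤fuel)

  #false≤fuel : #false s ≤ fuel
  #false≤fuel = ≤-trans (m≤n+m (#false s) (#true s)) (≤-trans (≤-reflexive (trans (#true+#false s) length-s)) n≤fuel)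

  Φv↭ : Φ fuel v ↭ upTo (#true (dual s))
  Φv↭ = subst (λ k → Φ fuel v ↭ upTo k) (sym (#true-dual s)) (Φ-↭ (#false s) #false≤fuel v↭)

  Φu↭ : Φ fuel u ↭ upTo (#false (dual s))
  Φu↭ = subst (λ k → Φ fuel u ↭ upTo k) (sym (#false-dual s)) (Φ-↭ (#true s) #true≤fuel u↭)

  open Assemble n (dual s) (trans (length-dual s) length-s) Φv↭ Φu↭ public
    renaming ( α to α′; β to β′; α<n to α′<n; β<n to β′<n; α++n∷β↭ to α′++n∷β′↭
             ; breakAt-α++n∷β to breakAt-α′++n∷β′; shuffleOf-α to shuffleOf-α′
             ; standardize-α to standardize-α′; standardize-β to standardize-β′)

  Φw≡α′++n∷β′ : Φ (suc fuel) w ≡ α′ ++ n ∷ β′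
  Φw≡α′++n∷β′ = Φ-unfold fuel n w (length-↭upTo w↭)

Φ-↭ : ∀ fuel m {w} → m ≤ fuel → w ↭ upTo m → Φ fuel w ↭ upTo m
Φ-↭ fuel       zero    _           w↭ rewrite ↭.↭-empty-inv w↭ = ↭-reflexive (Φ-[] fuel)
Φ-↭ (suc fuel) (suc n) (s≤s n≤fuel) w↭ = subst (_↭ upTo (suc n)) (sym Φw≡α′++n∷β′) α′++n∷β′↭
  where open Step fuel n n≤fuel w↭ (Φ-↭ fuel)

invᴸ-Φ : ∀ fuel m {w} → m ≤ fuel → w ↭ upTo m → invᴸ (Φ fuel w) ≡ mixᴸ w
invᴸ-Φ fuel       zero    _            w↭ rewrite ↭.↭-empty-inv w↭ = cong invᴸ (Φ-[] fuel)
invᴸ-Φ (suc fuel) (suc n) {w} (s≤s n≤fuel) w↭ = begin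
    invᴸ (Φ (suc fuel) w)
  ≡⟨ cong invᴸ Φw≡α′++n∷β′ ⟩
    invᴸ (α′ ++ n ∷ β′)
  ≡⟨ invᴸ-++-max n α′ β′ α′<n β′<n ⟩
    invᴸ α′ + invᴸ β′ + length β′ + invBetween α′ β′
  ≡⟨ cong₂ _+_ (cong₂ _+_ (cong₂ _+_ invᴸ-α′ invᴸ-β′) length-β′) invBetween-α′β′ ⟩
    mixᴸ v + mixᴸ u + #true s + crossings s
  ≡⟨ cong (λ t → t + #true s + crossings s) (+-comm (mixᴸ v) (mixᴸ u)) ⟩
    mixᴸ u + mixᴸ v + #true s + crossings s
  ≡⟨ sym (cong₂ _+_ (cong₂ _+_ (cong₂ _+_ mixᴸ-α mixᴸ-β) length-α) invBetween-αβ) ⟩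
    mixᴸ α + mixᴸ β + length α + invBetween α β
  ≡⟨ sym (mixᴸ-++-max n α β α<n β<n) ⟩
    mixᴸ (α ++ n ∷ β)
  ≡⟨ cong mixᴸ (sym w≡α++n∷β) ⟩
    mixᴸ w
  ∎
  where
  open Step fuel n n≤fuel w↭ (Φ-↭ fuel)
  s′ = dual s

  mixᴸ-α : mixᴸ α ≡ mixᴸ u
  mixᴸ-α = trans (cong mixᴸ (sym (map-trueIndex-standardize s α↭)))
                 (OrderEmbedding.mixᴸ-map (trueIndex s) (trueIndex-mono s) u)

  mixᴸ-β : mixᴸ β ≡ mixᴸ v
  mixᴸ-β = trans (cong mixᴸ (sym (map-trueIndex-standardize (map not s) β↭)))
                 (OrderEmbedding.mixᴸ-map (falseIndex s) (trueIndex-mono (map not s)) v)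

  length-α : length α ≡ #true s
  length-α = trans (↭.↭-length α↭) (length-trueIndices s)

  invBetween-αβ : invBetween α β ≡ crossings s
  invBetween-αβ = trans (invBetween-↭ˡ β α↭) (trans (invBetween-↭ʳ (trueIndices s) β↭) (invBetween-indices s))

  invᴸ-α′ : invᴸ α′ ≡ mixᴸ v
  invᴸ-α′ = trans (OrderEmbedding.invᴸ-map (trueIndex s′) (trueIndex-mono s′) (Φ fuel v))
                  (invᴸ-Φ fuel (#false s) #false≤fuel v↭)

  invᴸ-β′ : invᴸ β′ ≡ mixᴸ u
  invᴸ-β′ = trans (OrderEmbedding.invᴸ-map (falseIndex s′) (trueIndex-mono (map not s′)) (Φ fuel u))
                  (invᴸ-Φ fuel (#true s) #true≤fuel u↭)

  length-β′ : length β′ ≡ #true s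
  length-β′ = trans (length-map _ (Φ fuel u)) (length-↭upTo (Φ-↭ fuel (#true s) #true≤fuel u↭))

  invBetween-α′β′ : invBetween α′ β′ ≡ crossings s
  invBetween-α′β′ =
    trans (invBetween-↭ˡ β′ (map-trueIndex-↭ s′ Φv↭))
    (trans (invBetween-↭ʳ (trueIndices s′) (map-trueIndex-↭ (map not s′) Φu↭))
    (trans (invBetween-indices s′) (crossings-dual s)))

Φ-involutive : ∀ fuel m {w} → m ≤ fuel → w ↭ upTo m → Φ fuel (Φ fuel w) ≡ w
Φ-involutive fuel       zero    _            w↭ rewrite ↭.↭-empty-inv w↭ =
  trans (cong (Φ fuel) (Φ-[] fuel)) (Φ-[] fuel)
Φ-involutive (suc fuel) (suc n) {w} (s≤s n≤fuel) w↭ = begin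
    Φ (suc fuel) (Φ (suc fuel) w)
  ≡⟨ cong (Φ (suc fuel)) Φw≡α′++n∷β′ ⟩
    Φ (suc fuel) (α′ ++ n ∷ β′)
  ≡⟨ Φ-unfold fuel n (α′ ++ n ∷ β′) (length-↭upTo α′++n∷β′↭) ⟩
    glue (Φ fuel) n (breakAt n (α′ ++ n ∷ β′))
  ≡⟨ cong (glue (Φ fuel) n) breakAt-α′++n∷β′ ⟩
    glue (Φ fuel) n (α′ , β′)
  ≡⟨ cong (λ t → merge n (dual t) (Φ fuel (standardize β′)) (Φ fuel (standardize α′))) shuffleOf-α′ ⟩
    merge n (dual (dual s)) (Φ fuel (standardize β′)) (Φ fuel (standardize α′))
  ≡⟨ cong₂ (λ t x → merge n t x (Φ fuel (standardize α′))) (dual-involutive s) (cong (Φ fuel) standardize-β′) ⟩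
    merge n s (Φ fuel (Φ fuel u)) (Φ fuel (standardize α′))
  ≡⟨ cong (merge n s (Φ fuel (Φ fuel u)) ∘ Φ fuel) standardize-α′ ⟩
    merge n s (Φ fuel (Φ fuel u)) (Φ fuel (Φ fuel v))
  ≡⟨ cong₂ (merge n s) (Φ-involutive fuel (#true s) #true≤fuel u↭) (Φ-involutive fuel (#false s) #false≤fuel v↭) ⟩
    merge n s u v
  ≡⟨ cong₂ (λ a b → a ++ n ∷ b) (map-trueIndex-standardize s α↭) (map-trueIndex-standardize (map not s) β↭) ⟩
    α ++ n ∷ β
  ≡⟨ sym w≡α++n∷β ⟩
    w
  ∎
  where
  open Step fuel n n≤fuel w↭ (Φ-↭ fuel)

-- Permutations as words

permDec : ∀ {n} (v : Vec (Fin n) n) →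
          Dec (All (λ i → All (λ j → ¬ (i Fin.< j) ⊎ lookup v i ≢ lookup v j) (allFin n)) (allFin n))
permDec {n} v = all? (λ i → all? (λ j → ¬? (i Fin.<? j) ⊎-dec ¬? (lookup v i Fin.≟ lookup v j)) (allFin n)) (allFin n)

isPerm⇒injective : ∀ {n} (v : Vec (Fin n) n) → T (isPermB v) → ∀ i j → lookup v i ≡ lookup v j → i ≡ j
isPerm⇒injective v isPerm i j vi≡vj with toWitness {a? = permDec v} isPerm | Fin.<-cmp i j
... | _ | tri≈ _ i≡j _ = i≡j
... | W | tri< i<j _ _ with All.lookup (All.lookup W (∈-allFin i)) (∈-allFin j)
...   | inj₁ i≮j  = ⊥-elim (i≮j i<j)
...   | inj₂ vi≢vj = ⊥-elim (vi≢vj vi≡vj)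
isPerm⇒injective v isPerm i j vi≡vj | W | tri> _ _ j<i with All.lookup (All.lookup W (∈-allFin j)) (∈-allFin i)
...   | inj₁ j≮i  = ⊥-elim (j≮i j<i)
...   | inj₂ vj≢vi = ⊥-elim (vj≢vi (sym vi≡vj))

injective⇒isPerm : ∀ {n} (v : Vec (Fin n) n) → (∀ i j → lookup v i ≡ lookup v j → i ≡ j) → T (isPermB v)
injective⇒isPerm {n} v injective = fromWitness {a? = permDec v}
  (All.tabulate λ {i} _ → All.tabulate λ {j} _ → distinct i j)
  where
  distinct : ∀ i j → ¬ (i Fin.< j) ⊎ lookup v i ≢ lookup v j
  distinct i j with i Fin.<? j
  ... | yes i<j = inj₂ (λ vi≡vj → <-irrefl (cong toℕ (injective i j vi≡vj)) i<j)
  ... | no  i≮j = inj₁ i≮j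

injective⇒surjective : ∀ {n} (g : Fin n → Fin n) → (∀ i j → g i ≡ g j → i ≡ j) → ∀ y → ∃ λ i → g i ≡ y
injective⇒surjective {suc n} g injective y with Fin.any? (λ i → g i Fin.≟ y)
... | yes hit = hit
... | no  miss with Fin.pigeonhole (n<1+n n) (λ i → Fin.punchOut {i = y} (λ y≡gi → miss (i , sym y≡gi)))
...   | i , j , i<j , eq = ⊥-elim (<-irrefl (cong toℕ (injective i j
          (Fin.punchOut-injective {i = y} (λ e → miss (i , sym e)) (λ e → miss (j , sym e)) eq))) i<j)

Unique-tabulate⇒injective : ∀ {A : Set} m (f : Fin m → A) → Unique (tabulate f) → ∀ i j → f i ≡ f j → i ≡ j
Unique-tabulate⇒injective (suc m) f (_ ∷ _)   zero    zero    _   = refl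
Unique-tabulate⇒injective (suc m) f (f0∉ ∷ _) zero    (suc j) eq  = ⊥-elim (All.lookup f0∉ (∈-tabulate⁺ j) eq)
Unique-tabulate⇒injective (suc m) f (f0∉ ∷ _) (suc i) zero    eq  = ⊥-elim (All.lookup f0∉ (∈-tabulate⁺ i) (sym eq))
Unique-tabulate⇒injective (suc m) f (_ ∷ u)   (suc i) (suc j) eq  = cong suc (Unique-tabulate⇒injective m (f ∘ suc) u i j eq)

toWord-↭ : ∀ {n} (π : Perm n) → toWord π ↭ upTo n
toWord-↭ {n} π = ∼bag⇒↭ (unique∧set⇒bag unique (Unique.upTo⁺ n) (mk⇔ to from))
  where
  injective : ∀ i j → lookup (word π) i ≡ lookup (word π) j → i ≡ j
  injective = isPerm⇒injective (word π) (isPerm π)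
  unique : Unique (toWord π)
  unique = Unique.tabulate⁺ (λ {i} {j} eq → injective i j (Fin.toℕ-injective eq))
  to : ∀ {x} → x ∈ toWord π → x ∈ upTo n
  to x∈ with ∈-tabulate⁻ x∈
  ... | i , refl = ∈-upTo⁺ (Fin.toℕ<n (lookup (word π) i))
  from : ∀ {x} → x ∈ upTo n → x ∈ toWord π
  from x∈ with injective⇒surjective (lookup (word π)) injective (fromℕ< (∈-upTo⁻ x∈))
  ... | i , eq = subst (_∈ toWord π) (trans (cong toℕ eq) (Fin.toℕ-fromℕ< (∈-upTo⁻ x∈))) (∈-tabulate⁺ i)

toVec : ∀ {n} m (w : List ℕ) → length w ≡ m → All (_< n) w → Vec (Fin n) m
toVec zero    []      _  _           = []
toVec (suc m) (x ∷ w) eq (x<n ∷ w<n) = fromℕ< x<n ∷ toVec m w (suc-injective eq) w<n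

tabulate-toVec : ∀ {n} m w (eq : length w ≡ m) (w<n : All (_< n) w) → tabulate (toℕ ∘ lookup (toVec m w eq w<n)) ≡ w
tabulate-toVec zero    []      _  _           = refl
tabulate-toVec (suc m) (x ∷ w) eq (x<n ∷ w<n) = cong₂ _∷_ (Fin.toℕ-fromℕ< x<n) (tabulate-toVec m w (suc-injective eq) w<n)

fromWord : ∀ {n} (w : List ℕ) → w ↭ upTo n → Perm n
fromWord {n} w w↭ = perm v (injective⇒isPerm v injective)
  where
  w<n : All (_< n) w
  w<n = All.tabulate (λ x∈w → ∈-upTo⁻ (↭.∈-resp-↭ w↭ x∈w))
  v = toVec n w (length-↭upTo w↭) w<n
  injective : ∀ i j → lookup v i ≡ lookup v j → i ≡ j
  injective i j eq = Unique-tabulate⇒injective n (toℕ ∘ lookup v)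
    (subst Unique (sym (tabulate-toVec n w _ w<n)) (Unique-↭ (↭-sym w↭) (Unique.upTo⁺ n))) i j (cong toℕ eq)

toWord-fromWord : ∀ {n} (w : List ℕ) (w↭ : w ↭ upTo n) → toWord (fromWord w w↭) ≡ w
toWord-fromWord {n} w w↭ = tabulate-toVec n w _ _

tabulate-toℕ-injective : ∀ {n} m (v v′ : Vec (Fin n) m) →
  tabulate (toℕ ∘ lookup v) ≡ tabulate (toℕ ∘ lookup v′) → v ≡ v′
tabulate-toℕ-injective zero    []      []        _  = refl
tabulate-toℕ-injective (suc m) (a ∷ v) (a′ ∷ v′) eq with ∷-injective eq
... | a≡a′ , rest = cong₂ _∷_ (Fin.toℕ-injective a≡a′) (tabulate-toℕ-injective m v v′ rest)

toWord-injective : ∀ {n} (π π′ : Perm n) → toWord π ≡ toWord π′ → π ≡ π′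
toWord-injective {n} (perm v p) (perm v′ p′) eq with tabulate-toℕ-injective n v v′ eq
... | refl = cong (perm v) (T-irrelevant p p′)

involution-fibres-↔ : ∀ {A B : Set} (ι : A → A) (f g : A → B) →
  (∀ a → ι (ι a) ≡ a) → (∀ a → g (ι a) ≡ f a) → ∀ b → Σ A (λ a → f a ≡ b) ↔ Σ A (λ a → g a ≡ b)
involution-fibres-↔ {A} {B} ι f g ι-involutive g∘ι≡f b = mk↔ₛ′ to from to∘from from∘to
  where
  f∘ι≡g : ∀ a → f (ι a) ≡ g a
  f∘ι≡g a = trans (sym (g∘ι≡f (ι a))) (cong g (ι-involutive a))
  to : Σ A (λ a → f a ≡ b) → Σ A (λ a → g a ≡ b)
  to (a , fa≡b) = ι a , trans (g∘ι≡f a) fa≡b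
  from : Σ A (λ a → g a ≡ b) → Σ A (λ a → f a ≡ b)
  from (a , ga≡b) = ι a , trans (f∘ι≡g a) ga≡b
  fibre-≡ : ∀ {h : A → B} {a a′} {p : h a ≡ b} {q : h a′ ≡ b} → a ≡ a′ → (a , p) ≡ (a′ , q)
  fibre-≡ refl = cong (_ ,_) (uip _ _)
  to∘from : ∀ x → to (from x) ≡ x
  to∘from (a , _) = fibre-≡ (ι-involutive a)
  from∘to : ∀ x → from (to x) ≡ x
  from∘to (a , _) = fibre-≡ (ι-involutive a)

module _ {n : ℕ} where

  Φₚ : Perm n → Perm n
  Φₚ π = fromWord (Φ n (toWord π)) (Φ-↭ n n ≤-refl (toWord-↭ π))

  toWord-Φₚ : ∀ π → toWord (Φₚ π) ≡ Φ n (toWord π)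
  toWord-Φₚ π = toWord-fromWord _ (Φ-↭ n n ≤-refl (toWord-↭ π))

  inv-Φₚ : ∀ π → inv (Φₚ π) ≡ mix′ π
  inv-Φₚ π = begin
    inv (Φₚ π)              ≡⟨ inv≡invᴸ (Φₚ π) ⟩
    invᴸ (toWord (Φₚ π))    ≡⟨ cong invᴸ (toWord-Φₚ π) ⟩
    invᴸ (Φ n (toWord π))   ≡⟨ invᴸ-Φ n n ≤-refl (toWord-↭ π) ⟩
    mixᴸ (toWord π)         ≡⟨ sym (mix′≡mixᴸ π) ⟩
    mix′ π                  ∎

  Φₚ-involutive : ∀ π → Φₚ (Φₚ π) ≡ π
  Φₚ-involutive π = toWord-injective _ π (begin
    toWord (Φₚ (Φₚ π))       ≡⟨ toWord-Φₚ (Φₚ π) ⟩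
    Φ n (toWord (Φₚ π))      ≡⟨ cong (Φ n) (toWord-Φₚ π) ⟩
    Φ n (Φ n (toWord π))     ≡⟨ Φ-involutive n n ≤-refl (toWord-↭ π) ⟩
    toWord π                 ∎)

open import Data.Integer using (ℤ; +_)

mainTheorem9 : (n : ℕ) (m : ℤ) (k : ℕ) →
    ((Σ (Perm n) (λ π → + (mix′ π) ≡ m) ↔ Fin k)
      ⇔ (Σ (Perm n) (λ π → + (inv π) ≡ m) ↔ Fin k))
mainTheorem9 n m k = mk⇔ (↔-trans (↔-sym fibres↔)) (↔-trans fibres↔)
  where
  fibres↔ : Σ (Perm n) (λ π → + (mix′ π) ≡ m) ↔ Σ (Perm n) (λ π → + (inv π) ≡ m)
  fibres↔ = involution-fibres-↔ Φₚ (+_ ∘ mix′) (+_ ∘ inv) Φₚ-involutive (cong +_ ∘ inv-Φₚ) m
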